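{- Let $Q,R,S\in\mathfrak{P}$ with $Q\cap R=\emptyset$, $Q\cap S=\emptyset$; let $Y$ be the carrier of $Q$ and $X$ the carrier of $R$. Let $\epsilon:\mathcal{E}(Q\oplus R)\to\mathcal{E}(Q\oplus S)$ be an injective homomorphism (with respect to $\le_+$) such that for every $P\in\mathfrak{P}_r$, $\xi\in\mathcal{H}(P,Q\oplus R)$, $x\in P$ we have $\alpha_{P,\eta(\xi)}(x)=\epsilon(\alpha_{P,\xi}(x))$, where $\eta(\xi)(z):=\epsilon(\alpha_{P,\xi}(z))_1$. Put $\mathcal{E}(Q)^*:=\{(y,D,U\cup X):(y,D,U)\in\mathcal{E}(Q)\}$, $\mathcal{E}(R)^*:=\{(x,D\cup Y,U):(x,D,U)\in\mathcal{E}(R)\}$, $\mathcal{E}(S)^*:=\{(x,D\cup Y,U):(x,D,U)\in\mathcal{E}(S)\}$. Then $\{\epsilon(\mathfrak b)_1:\mathfrak b\in\mathcal{E}(R)^*\}\subseteq S$; and if $Y\subseteq\{\epsilon(\mathfrak a)_1:\mathfrak a\in\mathcal{E}(Q)^*\}$, then $\epsilon(\mathcal{E}(R)^*)\subseteq\mathcal{E}(S)^*$.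
   Context: $\mathfrak{P}$ is the class of finite nonempty posets and $\mathfrak{P}_r$ a fixed system of representatives of its isomorphism classes. $\mathcal{H}(P,Q)$ is the set of order-preserving maps $P\to Q$. $A\oplus B$ is the ordinal sum of disjoint posets (every element of $A$ below every element of $B$). For $A\subseteq P$, $x\in A$: $\gamma_A(x)$ is the set of $y\in A$ joined to $x$ by a sequence $x=z_0,\dots,z_L=y$ in $A$ ($L\ge0$) with consecutive elements strictly comparable; for a map $\xi$ on $P$, $G_\xi(x):=\gamma_{\xi^{ -1}(\xi(x))}(x)$. For $A\subseteq P$, ${\downarrow^{\circ}}A:=\{y: y\le a\text{ for some }a\in A\}\setminus A$, ${\uparrow_{\circ}}A:=\{y: y\ge a\text{ for some }a\in A\}\setminus A$. The EV-system $\mathcal{E}(P)$ is the set of triples $(x,D,U)$ with $x\in P$, $D\subseteq{\downarrow^{\circ}}\{x\}$, $U\subseteq{\uparrow_{\circ}}\{x\}$; $\mathfrak a<_+\mathfrak b$ iff $\mathfrak a_1\in\mathfrak b_2$ and $\mathfrak b_1\in\mathfrak a_3$; $\le_+$ is $<_+$ plus equality; a homomorphism $f$ between EV-systems satisfies $\mathfrak a\le_+\mathfrak b\Rightarrow f(\mathfrak a)\le_+ f(\mathfrak b)$. For $\xi\in\mathcal{H}(P,Q)$, $\alpha_{P,\xi}(x):=(\xi(x),\xi({\downarrow^{\circ}}G_\xi(x)),\xi({\uparrow_{\circ}}G_\xi(x)))$. -}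

module Defs where

open import Level using (0ℓ)
open import Data.Nat using (ℕ; suc)
open import Data.Fin using (Fin)
open import Data.Sum using (_⊎_; inj₁; inj₂)
open import Data.Product using (Σ; ∃; _×_; _,_; proj₁; proj₂)
open import Data.Empty using (⊥)
open import Data.Unit using (⊤)
open import Relation.Nullary using (¬_)
open import Relation.Binary.PropositionalEquality using (_≡_; _≢_; refl; sym; trans; subst; cong)
open import Relation.Binary.Structures using (IsPartialOrder)
open import Relation.Binary.Core using (Rel)
open import Relation.Unary using (Pred; _⊆_; _∪_)
open import Function.Bundles using (_↔_; _⇔_)

record RawOrder : Set₁ where
  field
    Carrier : Set
    _≤_     : Rel Carrier 0ℓ

record FinPoset : Set₁ where
  field
    Carrier        : Set
    _≤_            : Rel Carrier 0ℓ
    isPartialOrder : IsPartialOrder _≡_ _≤_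
    size           : ℕ
    enum           : Carrier ↔ Fin (suc size)

  raw : RawOrder
  raw = record { Carrier = Carrier ; _≤_ = _≤_ }

module _ (Q R : FinPoset) where
  private
    module Q = FinPoset Q
    module R = FinPoset R

  ⊕-≤ : Rel (Q.Carrier ⊎ R.Carrier) 0ℓ
  ⊕-≤ (inj₁ a) (inj₁ b) = a Q.≤ b
  ⊕-≤ (inj₁ a) (inj₂ b) = ⊤
  ⊕-≤ (inj₂ a) (inj₁ b) = ⊥
  ⊕-≤ (inj₂ a) (inj₂ b) = a R.≤ b

  _⊕_ : RawOrder
  _⊕_ = record { Carrier = Q.Carrier ⊎ R.Carrier ; _≤_ = ⊕-≤ }

img : {A B : Set} → (A → B) → Pred A 0ℓ → Pred B 0ℓ
img f S b = ∃ λ a → S a × f a ≡ b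

module Notions (O : RawOrder) where
  open RawOrder O

  _<_ : Rel Carrier 0ℓ
  x < y = (x ≤ y) × (x ≢ y)

  StrictlyComparable : Rel Carrier 0ℓ
  StrictlyComparable x y = (x < y) ⊎ (y < x)

  down° : Pred Carrier 0ℓ → Pred Carrier 0ℓ
  down° A y = (∃ λ a → A a × y ≤ a) × ¬ A y

  up° : Pred Carrier 0ℓ → Pred Carrier 0ℓ
  up° A y = (∃ λ a → A a × a ≤ y) × ¬ A y

  singleton : Carrier → Pred Carrier 0ℓ
  singleton x y = y ≡ x

  data Chain (A : Pred Carrier 0ℓ) (x : Carrier) : Carrier → Set where
    start : A x → Chain A x x
    step  : ∀ {y z} → Chain A x y → A z → StrictlyComparable y z → Chain A x z

  γ : Pred Carrier 0ℓ → Carrier → Pred Carrier 0ℓ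
  γ A x = Chain A x

  chain-end : ∀ {A x y} → Chain A x y → A y
  chain-end (start a)    = a
  chain-end (step _ a _) = a

  record Triple : Set₁ where
    constructor ⟨_,_,_⟩
    field
      pt : Carrier
      D  : Pred Carrier 0ℓ
      U  : Pred Carrier 0ℓ
  open Triple public

  IsEV : Triple → Set
  IsEV t = (D t ⊆ down° (singleton (pt t))) × (U t ⊆ up° (singleton (pt t)))

  EV : Set₁
  EV = Σ Triple IsEV

  _≈_ : Triple → Triple → Set
  a ≈ b = (pt a ≡ pt b) × (∀ y → D a y ⇔ D b y) × (∀ y → U a y ⇔ U b y)

  _<+_ : Triple → Triple → Set
  a <+ b = D b (pt a) × U a (pt b)

  _≤+_ : Triple → Triple → Set
  a ≤+ b = (a <+ b) ⊎ (a ≈ b)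

module Maps (P O : RawOrder) where
  private
    module P = RawOrder P
    module O = RawOrder O
    module NP = Notions P
    module NO = Notions O

  Monotone : (P.Carrier → O.Carrier) → Set
  Monotone ξ = ∀ {a b} → a P.≤ b → ξ a O.≤ ξ b

  G : (P.Carrier → O.Carrier) → P.Carrier → Pred P.Carrier 0ℓ
  G ξ x = NP.γ (λ p → ξ p ≡ ξ x) x

  α : (P.Carrier → O.Carrier) → P.Carrier → NO.Triple
  α ξ x = NO.⟨ ξ x , img ξ (NP.down° (G ξ x)) , img ξ (NP.up° (G ξ x)) ⟩

  α-EV : (ξ : P.Carrier → O.Carrier) → Monotone ξ → ∀ x → NO.IsEV (α ξ x)
  α-EV ξ mono x = dpart , upart
    where
      dpart : NO.D (α ξ x) ⊆ NO.down° (NO.singleton (ξ x))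
      dpart {q} (p , ((a , Ga , p≤a) , p∉G) , ξp≡q) =
        (ξ x , refl , subst (λ t → t O.≤ ξ x) ξp≡q
                        (subst (λ t → ξ p O.≤ t) (NP.chain-end Ga) (mono p≤a)))
        , λ q≡ξx → p∉G (NP.step Ga (trans ξp≡q q≡ξx)
                          (inj₂ (p≤a , λ p≡a → p∉G (subst (G ξ x) (sym p≡a) Ga))))
      upart : NO.U (α ξ x) ⊆ NO.up° (NO.singleton (ξ x))
      upart {q} (p , ((a , Ga , a≤p) , p∉G) , ξp≡q) =
        (ξ x , refl , subst (λ t → ξ x O.≤ t) ξp≡q
                        (subst (λ t → t O.≤ ξ p) (NP.chain-end Ga) (mono a≤p)))
        , λ q≡ξx → p∉G (NP.step Ga (trans ξp≡q q≡ξx)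
                          (inj₁ (a≤p , λ a≡p → p∉G (subst (G ξ x) a≡p Ga))))

module Star (Q R : FinPoset) where
  private
    module Q  = FinPoset Q
    module R  = FinPoset R
    module NQ = Notions (FinPoset.raw Q)
    module NR = Notions (FinPoset.raw R)
    module NQR = Notions (Q ⊕ R)

  Yset : Pred (Q.Carrier ⊎ R.Carrier) 0ℓ
  Yset z = ∃ λ (y : Q.Carrier) → inj₁ y ≡ z

  Xset : Pred (Q.Carrier ⊎ R.Carrier) 0ℓ
  Xset z = ∃ λ (x : R.Carrier) → inj₂ x ≡ z

  starL : NQ.Triple → NQR.Triple
  starL t = NQR.⟨ inj₁ (NQ.pt t) , img inj₁ (NQ.D t) , img inj₁ (NQ.U t) ∪ Xset ⟩

  starR : NR.Triple → NQR.Triple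
  starR t = NQR.⟨ inj₂ (NR.pt t) , img inj₂ (NR.D t) ∪ Yset , img inj₂ (NR.U t) ⟩

  InStarL : NQR.Triple → Set₁
  InStarL b = ∃ λ (a : NQ.EV) → b NQR.≈ starL (proj₁ a)

  InStarR : NQR.Triple → Set₁
  InStarR b = ∃ λ (a : NR.EV) → b NQR.≈ starR (proj₁ a)

module EpsilonProps (Q R S : FinPoset) where
  private
    module A = Notions (Q ⊕ R)
    module B = Notions (Q ⊕ S)

  -- ε is a well-defined map on sets (subsets are compared extensionally)
  Respects≈ : (A.EV → B.EV) → Set₁
  Respects≈ ε = ∀ (a b : A.EV) → proj₁ a A.≈ proj₁ b → proj₁ (ε a) B.≈ proj₁ (ε b)

  Injective≈ : (A.EV → B.EV) → Set₁
  Injective≈ ε = ∀ (a b : A.EV) → proj₁ (ε a) B.≈ proj₁ (ε b) → proj₁ a A.≈ proj₁ b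

  IsHom : (A.EV → B.EV) → Set₁
  IsHom ε = ∀ (a b : A.EV) → proj₁ a A.≤+ proj₁ b → proj₁ (ε a) B.≤+ proj₁ (ε b)

  η : (ε : A.EV → B.EV) (P : FinPoset) (ξ : FinPoset.Carrier P → RawOrder.Carrier (Q ⊕ R))
      → Maps.Monotone (FinPoset.raw P) (Q ⊕ R) ξ
      → FinPoset.Carrier P → RawOrder.Carrier (Q ⊕ S)
  η ε P ξ mono z =
    B.pt (proj₁ (ε (Maps.α (FinPoset.raw P) (Q ⊕ R) ξ z , Maps.α-EV (FinPoset.raw P) (Q ⊕ R) ξ mono z)))

  AlphaCompatible : (A.EV → B.EV) → Set₁
  AlphaCompatible ε =
    ∀ (P : FinPoset) (ξ : FinPoset.Carrier P → RawOrder.Carrier (Q ⊕ R))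
      (mono : Maps.Monotone (FinPoset.raw P) (Q ⊕ R) ξ) (x : FinPoset.Carrier P)
    → Maps.α (FinPoset.raw P) (Q ⊕ S) (η ε P ξ mono) x
        B.≈ proj₁ (ε (Maps.α (FinPoset.raw P) (Q ⊕ R) ξ x , Maps.α-EV (FinPoset.raw P) (Q ⊕ R) ξ mono x))

-- Suppose ε sent some b ∈ ℰ(R)* to a point q ∈ Q. A strictly descending chain
-- c₀ > … > cₘ in Q yields an injective ξ : (m+2)ᵒᵖ → Q ⊕ R with ξ(0) = b₁ ∈ X and
-- ξ(j+1) = cⱼ. As ε is an injective homomorphism, η(ξ) is strictly monotone, and
-- α-compatibility applied to α(1) <₊ b forces η(ξ)(0) = ε(b)₁ = q; so η(ξ) is a
-- strictly descending chain of length m + 2 in Q. Iterating exceeds the size of Q.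
-- For the second claim, every y ∈ Y is ε(a)₁ with a ∈ ℰ(Q)* and a <₊ b, so y lies in
-- ε(b)₂, while no point of Y lies above ε(b)₁ ∈ S.
module Submission where

open import Defs
open import Data.Nat using (ℕ; zero; suc; z≤n; s≤s)
open import Data.Nat.Properties using (n<1+n; <⇒≤)
open import Data.Fin as F using (Fin; zero; suc)
import Data.Fin.Properties as F
open import Data.Sum using (_⊎_; inj₁; inj₂)
open import Data.Sum.Properties using (inj₁-injective)
open import Data.Unit using (tt)
open import Data.Product using (Σ; ∃; _×_; _,_; proj₁; proj₂)
open import Data.Empty using (⊥-elim)
open import Function.Base using (_∘_; _∋_; flip)
open import Function.Bundles using (Inverse; Injection; Equivalence; mk⇔)
open import Function.Construct.Identity using (↔-id)
open import Function.Definitions using (Injective)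
open import Function.Properties.Inverse using (↔⇒↣)
open import Relation.Nullary using (¬_; yes; no)
open import Relation.Binary.Definitions using (tri<; tri≈; tri>)
open import Relation.Binary.Structures using (IsPartialOrder)
open import Relation.Binary.PropositionalEquality
  using (_≡_; _≢_; refl; sym; trans; subst; subst₂; cong)
import Relation.Binary.Construct.Flip.EqAndOrd as Flip
open import Relation.Unary using (_⊆_; _∪_)

inj₁≢inj₂ : ∀ {A B : Set} {a : A} {b : B} → (A ⊎ B ∋ inj₁ a) ≢ inj₂ b
inj₁≢inj₂ ()

<1⇒≡0 : ∀ {n} {w : Fin (suc (suc n))} → w F.< (Fin (suc (suc n)) ∋ suc zero) → w ≡ zero
<1⇒≡0 {w = zero}  _           = refl
<1⇒≡0 {w = suc _} (s≤s ())

Finᵒᵖ : ℕ → FinPoset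
Finᵒᵖ n = record
  { Carrier        = Fin (suc n)
  ; _≤_            = flip F._≤_
  ; isPartialOrder = Flip.isPartialOrder F.≤-isPartialOrder
  ; size           = n
  ; enum           = ↔-id (Fin (suc n))
  }

module _ (O : RawOrder) where
  open RawOrder O
  open Notions O

  StrictlyDecreasing : ∀ {n} → (Fin n → Carrier) → Set
  StrictlyDecreasing f = ∀ {i j} → j F.< i → f i < f j

  strictlyDecreasing⇒injective : ∀ {n} {f : Fin n → Carrier} →
                                 StrictlyDecreasing f → Injective _≡_ _≡_ f
  strictlyDecreasing⇒injective f↓ {i} {j} fi≡fj with F.<-cmp i j
  ... | tri< i<j _ _ = ⊥-elim (proj₂ (f↓ i<j) (sym fi≡fj))
  ... | tri≈ _ i≡j _ = i≡j
  ... | tri> _ _ j<i = ⊥-elim (proj₂ (f↓ j<i) fi≡fj)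

  <+⇒< : ∀ {a b} → IsEV a → a <+ b → pt a < pt b
  <+⇒< (_ , U⊆up) (_ , b∈Ua) with U⊆up b∈Ua
  ... | (_ , refl , a≤b) , b≢a = a≤b , b≢a ∘ sym

finPoset-notInjective : (P : FinPoset) (f : Fin (suc (suc (FinPoset.size P))) → FinPoset.Carrier P) →
              ¬ Injective _≡_ _≡_ f
finPoset-notInjective P f f-inj =
  F.<⇒notInjective (n<1+n _) (f-inj ∘ Injection.injective (↔⇒↣ (FinPoset.enum P)))

module _ (P O : RawOrder) {ξ : RawOrder.Carrier P → RawOrder.Carrier O}
         (ξ-inj : Injective _≡_ _≡_ ξ) where
  private
    module P = Notions P
    module O = Notions O
  open Maps P O

  G-injective : ∀ {x y} → G ξ x y → y ≡ x
  G-injective = ξ-inj ∘ P.chain-end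

  α-<+ : ∀ {a b} → a P.< b → α ξ a O.<+ α ξ b
  α-<+ {a} {b} (a≤b , a≢b) =
      (a , ((b , P.start refl , a≤b) , a≢b ∘ G-injective) , refl)
    , (b , ((a , P.start refl , a≤b) , a≢b ∘ sym ∘ G-injective) , refl)

  U-α : ∀ {x z} → O.U (α ξ x) z → ∃ λ w → x P.< w × ξ w ≡ z
  U-α (w , ((g , g∈G , g≤w) , w∉G) , ξw≡z) with G-injective g∈G
  ... | refl = w , (g≤w , λ { refl → w∉G g∈G }) , ξw≡z

module _ (Q R : FinPoset) where
  private
    module R  = FinPoset R
    module A  = Notions (Q ⊕ R)
    module NR = Notions (FinPoset.raw R)
  open Star Q R

  InStarR⇒Y⊆D : ∀ {b} → InStarR b → Yset ⊆ A.D b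
  InStarR⇒Y⊆D (_ , b≈) {z} y = Equivalence.from (proj₁ (proj₂ b≈) z) (inj₂ y)

  starL<+starR : ∀ {a b} → InStarL a → InStarR b → a A.<+ b
  starL<+starR {b = b} (_ , a≈) b∈R* =
      InStarR⇒Y⊆D b∈R* (_ , sym (proj₁ a≈))
    , Equivalence.from (proj₂ (proj₂ a≈) (A.pt b)) (inj₂ (_ , sym (proj₁ (proj₂ b∈R*))))

  starL-pt≢starR-pt : ∀ {a b} → InStarL a → InStarR b → A.pt a ≢ A.pt b
  starL-pt≢starR-pt (_ , a≈) (_ , b≈) a≡b = inj₁≢inj₂ (trans (sym (proj₁ a≈)) (trans a≡b (proj₁ b≈)))

  restrictR : A.Triple → R.Carrier → NR.Triple
  restrictR c r = NR.⟨ r , (λ r′ → A.D c (inj₂ r′)) , (λ r′ → A.U c (inj₂ r′)) ⟩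

  restrictR-isEV : (c : A.EV) {r : R.Carrier} → A.pt (proj₁ c) ≡ inj₂ r →
                   NR.IsEV (restrictR (proj₁ c) r)
  restrictR-isEV (c , D⊆down , U⊆up) {r} c≡r = D-EV , U-EV
    where
      r′≢r : ∀ {r′} → inj₂ r′ ≢ A.pt c → r′ ≢ r
      r′≢r r′≢c r′≡r = r′≢c (trans (cong inj₂ r′≡r) (sym c≡r))

      D-EV : NR.D (restrictR c r) ⊆ NR.down° (NR.singleton r)
      D-EV {r′} d with D⊆down d
      ... | (_ , refl , r′≤c) , r′≢c =
        (r , refl , subst (⊕-≤ Q R (inj₂ r′)) c≡r r′≤c) , r′≢r r′≢c

      U-EV : NR.U (restrictR c r) ⊆ NR.up° (NR.singleton r)
      U-EV {r′} u with U⊆up u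
      ... | (_ , refl , c≤r′) , r′≢c =
        (r , refl , subst (flip (⊕-≤ Q R) (inj₂ r′)) c≡r c≤r′) , r′≢r r′≢c

  Y⊆D⇒InStarR : (c : A.EV) {r : R.Carrier} → A.pt (proj₁ c) ≡ inj₂ r →
                Yset ⊆ A.D (proj₁ c) → InStarR (proj₁ c)
  Y⊆D⇒InStarR c@(t , _ , U⊆up) {r} c≡r Y⊆D =
    (restrictR t r , restrictR-isEV c c≡r) , c≡r ,
    (λ z → mk⇔ (D-to z) (D-from z)) , (λ z → mk⇔ (U-to z) U-from)
    where
      D-to : ∀ z → A.D t z → (img inj₂ (NR.D (restrictR t r)) ∪ Yset) z
      D-to (inj₁ y)  _ = inj₂ (y , refl)
      D-to (inj₂ r′) d = inj₁ (r′ , d , refl)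

      D-from : ∀ z → (img inj₂ (NR.D (restrictR t r)) ∪ Yset) z → A.D t z
      D-from _ (inj₁ (_ , d , refl)) = d
      D-from _ (inj₂ y)              = Y⊆D y

      U-to : ∀ z → A.U t z → img inj₂ (NR.U (restrictR t r)) z
      U-to (inj₂ r′) u = r′ , u , refl
      U-to (inj₁ y)  u with U⊆up u
      ... | (_ , refl , t≤y) , _ = ⊥-elim (subst (flip (⊕-≤ Q R) (inj₁ y)) c≡r t≤y)

      U-from : ∀ {z} → img inj₂ (NR.U (restrictR t r)) z → A.U t z
      U-from (_ , u , refl) = u

module _ (Q R S : FinPoset) (ε : Notions.EV (Q ⊕ R) → Notions.EV (Q ⊕ S))
         (ε-inj : EpsilonProps.Injective≈ Q R S ε) (ε-hom : EpsilonProps.IsHom Q R S ε) where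
  private
    module Q  = FinPoset Q
    module NQ = Notions (FinPoset.raw Q)
    module A  = Notions (Q ⊕ R)
    module B  = Notions (Q ⊕ S)

  ε-<+ : ∀ a b → proj₁ a A.<+ proj₁ b → A.pt (proj₁ a) ≢ A.pt (proj₁ b) →
         proj₁ (ε a) B.<+ proj₁ (ε b)
  ε-<+ a b a<+b a≢b with ε-hom a b (inj₁ a<+b)
  ... | inj₁ εa<+εb = εa<+εb
  ... | inj₂ εa≈εb  = ⊥-elim (a≢b (proj₁ (ε-inj a b εa≈εb)))

  module _ (P : FinPoset) {ξ : FinPoset.Carrier P → RawOrder.Carrier (Q ⊕ R)}
           (ξ-mono : Maps.Monotone (FinPoset.raw P) (Q ⊕ R) ξ) where
    private
      module P = Notions (FinPoset.raw P)
      open Maps (FinPoset.raw P) (Q ⊕ R)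
      η = EpsilonProps.η Q R S ε P ξ ξ-mono

    αₑ : FinPoset.Carrier P → A.EV
    αₑ x = α ξ x , α-EV ξ ξ-mono x

    η-strictlyMonotone : Injective _≡_ _≡_ ξ → ∀ {a b} → a P.< b → η a B.< η b
    η-strictlyMonotone ξ-inj {a} {b} a<b =
      <+⇒< (Q ⊕ S) {b = proj₁ (ε (αₑ b))} (proj₂ (ε (αₑ a)))
        (ε-<+ (αₑ a) (αₑ b) (α-<+ (FinPoset.raw P) (Q ⊕ R) ξ-inj a<b) (proj₂ a<b ∘ ξ-inj))

  DescendingChain : ℕ → Set
  DescendingChain n = Σ (Fin (suc n) → Q.Carrier) (StrictlyDecreasing (FinPoset.raw Q))

  module _ (compat : EpsilonProps.AlphaCompatible Q R S ε)
           {b : A.EV} (b∈R* : Star.InStarR Q R (proj₁ b))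
           {q : Q.Carrier} (εb≡q : B.pt (proj₁ (ε b)) ≡ inj₁ q) where

    module Extend {m} {c : Fin (suc m) → Q.Carrier}
                  (c↓ : StrictlyDecreasing (FinPoset.raw Q) c) where
      P : FinPoset
      P = Finᵒᵖ (suc m)

      x : FinPoset.Carrier R
      x = Notions.pt (proj₁ (proj₁ b∈R*))

      b≡x : A.pt (proj₁ b) ≡ inj₂ x
      b≡x = proj₁ (proj₂ b∈R*)

      ξ : Fin (suc (suc m)) → RawOrder.Carrier (Q ⊕ R)
      ξ zero    = inj₂ x
      ξ (suc j) = inj₁ (c j)

      ξ-mono : Maps.Monotone (FinPoset.raw P) (Q ⊕ R) ξ
      ξ-mono {zero}  {zero}  _ = IsPartialOrder.refl (FinPoset.isPartialOrder R)
      ξ-mono {suc _} {zero}  _ = tt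
      ξ-mono {suc i} {suc j} (s≤s j≤i) with i F.≟ j
      ... | yes refl = IsPartialOrder.refl Q.isPartialOrder
      ... | no i≢j   = proj₁ (c↓ (F.≤∧≢⇒< j≤i (i≢j ∘ sym)))

      ξ-inj : Injective _≡_ _≡_ ξ
      ξ-inj {zero}  {zero}  _ = refl
      ξ-inj {suc _} {suc _} e =
        cong suc (strictlyDecreasing⇒injective (FinPoset.raw Q) c↓ (inj₁-injective e))

      η : Fin (suc (suc m)) → RawOrder.Carrier (Q ⊕ S)
      η = EpsilonProps.η Q R S ε P ξ ξ-mono

      η↓ : StrictlyDecreasing (Q ⊕ S) η
      η↓ j<i = η-strictlyMonotone P ξ-mono ξ-inj (<⇒≤ j<i , F.<⇒≢ j<i ∘ sym)

      α₁<+b : proj₁ (αₑ P ξ-mono (suc zero)) A.<+ proj₁ b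
      α₁<+b = InStarR⇒Y⊆D Q R b∈R* (c zero , refl)
            , subst (A.U (Maps.α (FinPoset.raw P) (Q ⊕ R) ξ (suc zero))) (sym b≡x)
                (proj₂ (α-<+ (FinPoset.raw P) (Q ⊕ R) ξ-inj (z≤n , λ ())))

      -- ε(b)₁ lies strictly above η(1) in the image of η, and only 0 is strictly above 1.
      η-top : η zero ≡ B.pt (proj₁ (ε b))
      η-top with U-α (FinPoset.raw P) (Q ⊕ S) (strictlyDecreasing⇒injective (Q ⊕ S) η↓)
                   (Equivalence.from (proj₂ (proj₂ (compat P ξ ξ-mono (suc zero))) _)
                     (proj₂ (ε-<+ (αₑ P ξ-mono (suc zero)) b α₁<+b
                              (λ e → inj₁≢inj₂ (trans e b≡x)))))
      ... | w , (w≤1 , 1≢w) , ηw≡εb = subst (λ w → η w ≡ _) (<1⇒≡0 (F.≤∧≢⇒< w≤1 (1≢w ∘ sym))) ηw≡εb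

      η∈Q : ∀ i → Σ Q.Carrier λ y → η i ≡ inj₁ y
      η∈Q zero    = q , trans η-top εb≡q
      η∈Q (suc j) = below-inj₁ (η (suc j))
                      (subst (⊕-≤ Q S (η (suc j))) (trans η-top εb≡q) (proj₁ (η↓ (s≤s z≤n))))
        where
          below-inj₁ : ∀ z {y} → ⊕-≤ Q S z (inj₁ y) → Σ Q.Carrier λ y′ → z ≡ inj₁ y′
          below-inj₁ (inj₁ y′) _ = y′ , refl

      chain : DescendingChain (suc m)
      chain = proj₁ ∘ η∈Q , λ j<i → lower (subst₂ B._<_ (proj₂ (η∈Q _)) (proj₂ (η∈Q _)) (η↓ j<i))
        where
          lower : ∀ {y y′} → (RawOrder.Carrier (Q ⊕ S) ∋ inj₁ y) B.< inj₁ y′ → y NQ.< y′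
          lower (y≤y′ , y≢y′) = y≤y′ , y≢y′ ∘ cong inj₁

    descendingChain : ∀ n → DescendingChain n
    descendingChain zero    = (λ _ → Inverse.from Q.enum zero) , λ { {zero} {zero} () }
    descendingChain (suc n) = Extend.chain (proj₂ (descendingChain n))

  ε-starR-pt∈S : EpsilonProps.AlphaCompatible Q R S ε → (b : A.EV) → Star.InStarR Q R (proj₁ b) →
                 ∃ λ s → B.pt (proj₁ (ε b)) ≡ inj₂ s
  ε-starR-pt∈S compat b b∈R* with B.pt (proj₁ (ε b)) in εb≡
  ... | inj₂ s = s , refl
  ... | inj₁ _ =
    ⊥-elim (finPoset-notInjective Q (proj₁ long) (strictlyDecreasing⇒injective (FinPoset.raw Q) (proj₂ long)))
    where
      long : DescendingChain (suc Q.size)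
      long = descendingChain compat b∈R* εb≡ (suc Q.size)

  ε-starR∈S* : EpsilonProps.AlphaCompatible Q R S ε →
               (∀ y → ∃ λ (a : A.EV) → Star.InStarL Q R (proj₁ a) × B.pt (proj₁ (ε a)) ≡ inj₁ y) →
               (b : A.EV) → Star.InStarR Q R (proj₁ b) → Star.InStarR Q S (proj₁ (ε b))
  ε-starR∈S* compat Y⊆εL* b b∈R* =
    Y⊆D⇒InStarR Q S (ε b) (proj₂ (ε-starR-pt∈S compat b b∈R*)) Y⊆Dεb
    where
      Y⊆Dεb : Star.Yset Q S ⊆ B.D (proj₁ (ε b))
      Y⊆Dεb (y , refl) with Y⊆εL* y
      ... | a , a∈L* , εa≡y =
        subst (B.D (proj₁ (ε b))) εa≡y
          (proj₁ (ε-<+ a b (starL<+starR Q R a∈L* b∈R*) (starL-pt≢starR-pt Q R a∈L* b∈R*)))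

lemma6 : (Q R S : FinPoset)
         (ε : Notions.EV (Q ⊕ R) → Notions.EV (Q ⊕ S))
         → EpsilonProps.Respects≈ Q R S ε
         → EpsilonProps.Injective≈ Q R S ε
         → EpsilonProps.IsHom Q R S ε
         → EpsilonProps.AlphaCompatible Q R S ε
         → ((b : Notions.EV (Q ⊕ R)) → Star.InStarR Q R (proj₁ b)
              → ∃ λ s → Notions.pt (proj₁ (ε b)) ≡ inj₂ s)
           × ((∀ y → ∃ λ (a : Notions.EV (Q ⊕ R))
                       → Star.InStarL Q R (proj₁ a) × Notions.pt (proj₁ (ε a)) ≡ inj₁ y)
              → (b : Notions.EV (Q ⊕ R)) → Star.InStarR Q R (proj₁ b)
              → Star.InStarR Q S (proj₁ (ε b)))
lemma6 Q R S ε _ ε-inj ε-hom compat =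
  ε-starR-pt∈S Q R S ε ε-inj ε-hom compat , ε-starR∈S* Q R S ε ε-inj ε-hom compat
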